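{- Let $(C,\sqsubseteq)$ and $(A,\leq)$ be complete lattices. Let $E_C$ be a system of $m$ equations $x_i =_{\eta_i} f^C_i(x_1,\ldots,x_m)$ over $C$ and $E_A$ a system of $m$ equations $x_i =_{\eta_i} f^A_i(x_1,\ldots,x_m)$ over $A$ (same $\eta_i$), with monotone $f^C_i\colon C^m\to C$, $f^A_i\colon A^m\to A$, and solutions $\vec{s}^C\in C^m$, $\vec{s}^A\in A^m$. Let $\vec{\alpha},\vec{\gamma}$ be $m$-tuples of monotone functions such that $\langle\alpha_i,\gamma_i\rangle\colon C\to A$ is a Galois connection for each $i\in\{1,\ldots,m\}$. Then: (1) (Soundness) The conditions $\vec{f}^C\circ\vec{\gamma}^\times\sqsubseteq\vec{\gamma}^\times\circ\vec{f}^A$ and $\vec{\alpha}^\times\circ\vec{f}^C\leq\vec{f}^A\circ\vec{\alpha}^\times$ are equivalent, and if they hold then $\vec{\alpha}^\times(\vec{s}^C)\leq\vec{s}^A$ (equivalently $\vec{s}^C\sqsubseteq\vec{\gamma}^\times(\vec{s}^A)$). (2) (Completeness for abstraction) If $\vec{f}^A\circ\vec{\alpha}^\times\leq\vec{\alpha}^\times\circ\vec{f}^C$ and $\alpha_i$ is co-continuous and co-strict for each $i$ with $\eta_i=\nu$, then $\vec{s}^A\leq\vec{\alpha}^\times(\vec{s}^C)$. (3) (Completeness for concretisation) If $\vec{\gamma}^\times\circ\vec{f}^A\sqsubseteq\vec{f}^C\circ\vec{\gamma}^\times$ and $\gamma_i$ is continuous and strict for each $i$ with $\eta_i=\mu$,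 then $\vec{\gamma}^\times(\vec{s}^A)\sqsubseteq\vec{s}^C$.
   Context: A Galois connection $\langle\alpha,\gamma\rangle\colon C\to A$ between complete lattices is a pair of monotone maps $\alpha\colon C\to A$, $\gamma\colon A\to C$ with $\alpha(c)\leq a$ iff $c\sqsubseteq\gamma(a)$. Tuples are ordered pointwise; a tuple $\vec{f}$ of functions $f_i\colon L^m\to L$ is viewed as a function $L^m\to L^m$; for a tuple $\vec{\beta}$ of functions $\beta_i\colon X\to Y$, $\vec{\beta}^\times\colon X^m\to Y^m$ is $\vec{\beta}^\times(x_1,\ldots,x_m)=(\beta_1(x_1),\ldots,\beta_m(x_m))$. A system of equations over a complete lattice $L$ is a list $x_i=_{\eta_i} f_i(x_1,\ldots,x_m)$, $i=1,\ldots,m$, with $f_i$ monotone and $\eta_i\in\{\mu,\nu\}$. $E[x_i:=l]$ is the system of $m-1$ equations obtained by removing the $i$-th equation and substituting $l$ for $x_i$ elsewhere. The solution is defined inductively: $\mathrm{sol}(\emptyset)=()$ and $\mathrm{sol}(E)=(\mathrm{sol}(E[x_m:=s_m]),s_m)$ with $s_m=\eta_m(\lambda x.\,f_m(\mathrm{sol}(E[x_m:=x]),x))$, where $\mu g,\nu g$ denote least/greatest fixpoints. Continuous = preserves joins of directed sets; strict = preserves bottom; co-continuous = preserves meets of filtered (downward directed) sets; co-strict = preserves top. -}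

module Defs where

open import Level using (Level)
open import Data.Nat using (ℕ; zero; suc)
open import Data.Fin using (Fin; zero; suc; fromℕ; inject₁)
open import Data.Product using (Σ; _×_; _,_)
open import Data.Empty.Polymorphic using (⊥)
open import Relation.Binary.Structures using (IsPartialOrder)

record CompleteLattice (ℓ : Level) : Set (Level.suc ℓ) where
  infix 4 _≈_ _≤_
  field
    Carrier        : Set ℓ
    _≈_            : Carrier → Carrier → Set ℓ
    _≤_            : Carrier → Carrier → Set ℓ
    isPartialOrder : IsPartialOrder _≈_ _≤_
    ⋁              : (Carrier → Set ℓ) → Carrier
    ⋁-upper        : ∀ (P : Carrier → Set ℓ) x → P x → x ≤ ⋁ P
    ⋁-least        : ∀ (P : Carrier → Set ℓ) y → (∀ x → P x → x ≤ y) → ⋁ P ≤ y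
    ⋀              : (Carrier → Set ℓ) → Carrier
    ⋀-lower        : ∀ (P : Carrier → Set ℓ) x → P x → ⋀ P ≤ x
    ⋀-greatest     : ∀ (P : Carrier → Set ℓ) y → (∀ x → P x → y ≤ x) → y ≤ ⋀ P

  bot : Carrier
  bot = ⋁ (λ _ → ⊥)

  top : Carrier
  top = ⋀ (λ _ → ⊥)

Car : ∀ {ℓ} → CompleteLattice ℓ → Set ℓ
Car = CompleteLattice.Carrier

module _ {ℓ : Level} where

  Monotone : (C A : CompleteLattice ℓ) → (Car C → Car A) → Set ℓ
  Monotone C A f = ∀ x y → CompleteLattice._≤_ C x y → CompleteLattice._≤_ A (f x) (f y)

  record IsGaloisConnection (C A : CompleteLattice ℓ)
           (α : Car C → Car A) (γ : Car A → Car C) : Set ℓ where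
    field
      α-mono : Monotone C A α
      γ-mono : Monotone A C γ
      adjunction-⇒ : ∀ c a → CompleteLattice._≤_ A (α c) a → CompleteLattice._≤_ C c (γ a)
      adjunction-⇐ : ∀ c a → CompleteLattice._≤_ C c (γ a) → CompleteLattice._≤_ A (α c) a

  Directed : (L : CompleteLattice ℓ) → (Car L → Set ℓ) → Set ℓ
  Directed L D = Σ (Car L) D
    × (∀ x y → D x → D y → Σ (Car L) λ z → D z × (x ≤ z) × (y ≤ z))
    where open CompleteLattice L

  Filtered : (L : CompleteLattice ℓ) → (Car L → Set ℓ) → Set ℓ
  Filtered L D = Σ (Car L) D
    × (∀ x y → D x → D y → Σ (Car L) λ z → D z × (z ≤ x) × (z ≤ y))
    where open CompleteLattice L

  Image : (C A : CompleteLattice ℓ) → (Car C → Car A) → (Car C → Set ℓ) → Car A → Set ℓ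
  Image C A f D a = Σ (Car C) λ c → D c × CompleteLattice._≈_ A a (f c)

  Continuous : (C A : CompleteLattice ℓ) → (Car C → Car A) → Set (Level.suc ℓ)
  Continuous C A f = ∀ (D : Car C → Set ℓ) → Directed C D →
    CompleteLattice._≈_ A (f (CompleteLattice.⋁ C D)) (CompleteLattice.⋁ A (Image C A f D))

  CoContinuous : (C A : CompleteLattice ℓ) → (Car C → Car A) → Set (Level.suc ℓ)
  CoContinuous C A f = ∀ (D : Car C → Set ℓ) → Filtered C D →
    CompleteLattice._≈_ A (f (CompleteLattice.⋀ C D)) (CompleteLattice.⋀ A (Image C A f D))

  Strict : (C A : CompleteLattice ℓ) → (Car C → Car A) → Set ℓ
  Strict C A f = CompleteLattice._≈_ A (f (CompleteLattice.bot C)) (CompleteLattice.bot A)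

  CoStrict : (C A : CompleteLattice ℓ) → (Car C → Car A) → Set ℓ
  CoStrict C A f = CompleteLattice._≈_ A (f (CompleteLattice.top C)) (CompleteLattice.top A)

data Fix : Set where
  μ ν : Fix

snoc : ∀ {a} {X : Set a} {m : ℕ} → (Fin m → X) → X → Fin (suc m) → X
snoc {m = zero}  v x zero    = x
snoc {m = suc m} v x zero    = v zero
snoc {m = suc m} v x (suc i) = snoc (λ j → v (suc j)) x i

module Systems {ℓ : Level} (L : CompleteLattice ℓ) where
  open CompleteLattice L

  Tuple : ℕ → Set ℓ
  Tuple m = Fin m → Carrier

  _≤ᵗ_ : ∀ {m} → Tuple m → Tuple m → Set ℓ
  u ≤ᵗ v = ∀ i → u i ≤ v i

  MonotoneTuple : ∀ {m} → (Tuple m → Carrier) → Set ℓ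
  MonotoneTuple {m} g = ∀ u v → u ≤ᵗ v → g u ≤ g v

  -- least / greatest fixpoint (Knaster–Tarski: meet of pre-fixpoints / join of post-fixpoints)
  fp : Fix → (Carrier → Carrier) → Carrier
  fp μ g = ⋀ (λ x → g x ≤ x)
  fp ν g = ⋁ (λ x → x ≤ g x)

  sol : (m : ℕ) → (Fin m → Fix) → (Fin m → Tuple m → Carrier) → Tuple m
  sol zero    η f ()
  sol (suc m) η f = snoc (rest s) s
    where
      η′ : Fin m → Fix
      η′ i = η (inject₁ i)
      f′ : Carrier → Fin m → Tuple m → Carrier
      f′ l i v = f (inject₁ i) (snoc v l)
      rest : Carrier → Tuple m
      rest l = sol m η′ (f′ l)
      s : Carrier
      s = fp (η (fromℕ m)) (λ x → f (fromℕ m) (snoc (rest x) x))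

-- Both solutions are computed equation by equation, so it suffices to find a relation Rᵢ
-- for each variable that the right-hand sides preserve and that survives the fixpoint of
-- kind ηᵢ; induction on the number of equations then relates the solutions.  For soundness
-- Rᵢ c a is αᵢ c ≤ a: least fixpoints transfer along a left adjoint, greatest ones along
-- any monotone map.  In (2) the relation is a ≤ αᵢ c and in (3) it is γᵢ a ⊑ c.  The hard
-- case is a least fixpoint along a continuous strict h, done by Pataraia's theorem: the
-- post-fixpoints x of g with h x ≤ μ g′ contain ⊥ and are closed under g and directed
-- joins, so the join of all monotone inflationary maps on them sends ⊥ to a prefixed
-- point e of g, whence h (μ g) ≤ h e ≤ μ g′.  The co-continuous case is its order dual.
module Submission where

open import Defs
open import Level using (Level)
open import Data.Nat using (ℕ)
open import Data.Fin using (Fin)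
open import Data.Product using (_×_)
open import Function.Bundles using (_⇔_)
open import Relation.Binary.PropositionalEquality using (_≡_)

open import Data.Nat using (zero; suc)
open import Data.Fin using (zero; suc; inject₁; fromℕ)
open import Data.Product using (Σ; _,_; proj₁; proj₂)
open import Data.Vec.Functional using (init)
open import Function using (flip)
open import Function.Bundles using (mk⇔)
open import Relation.Binary.PropositionalEquality using (refl)
open import Relation.Binary.Structures using (IsPartialOrder)
open import Relation.Binary.Construct.Flip.EqAndOrd using ()
  renaming (isPartialOrder to flip-isPartialOrder)

private
  variable
    ℓ : Level

-- Systems.fp (L ᵒᵖ) μ is definitionally Systems.fp L ν, and vice versa.
_ᵒᵖ : CompleteLattice ℓ → CompleteLattice ℓ
L ᵒᵖ = record
  { Carrier = Carrier ; _≈_ = _≈_ ; _≤_ = flip _≤_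
  ; isPartialOrder = flip-isPartialOrder isPartialOrder
  ; ⋁ = ⋀ ; ⋁-upper = ⋀-lower ; ⋁-least = ⋀-greatest
  ; ⋀ = ⋁ ; ⋀-lower = ⋁-upper ; ⋀-greatest = ⋁-least
  }
  where open CompleteLattice L

dual : Fix → Fix
dual μ = ν
dual ν = μ

monotone-ᵒᵖ : (X Y : CompleteLattice ℓ) {h : Car X → Car Y} →
              Monotone X Y h → Monotone (X ᵒᵖ) (Y ᵒᵖ) h
monotone-ᵒᵖ X Y h-mono x y y≤x = h-mono y x y≤x

monotoneTuple-ᵒᵖ : (L : CompleteLattice ℓ) {m : ℕ} {f : (Fin m → Car L) → Car L} →
                   Systems.MonotoneTuple L f → Systems.MonotoneTuple (L ᵒᵖ) f
monotoneTuple-ᵒᵖ L f-mono u v v≤u = f-mono v u v≤u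

module Order (L : CompleteLattice ℓ) where
  open CompleteLattice L public
  open IsPartialOrder isPartialOrder public
    using (module Eq) renaming (refl to ≤-refl; trans to ≤-trans; reflexive to ≤-reflexive)
  open Systems L public using (fp)

  μ-prefixed : ∀ (g : Carrier → Carrier) → Monotone L L g → g (fp μ g) ≤ fp μ g
  μ-prefixed g g-mono =
    ⋀-greatest _ _ λ x gx≤x → ≤-trans (g-mono _ x (⋀-lower _ x gx≤x)) gx≤x

  ⊥-least : ∀ x → bot ≤ x
  ⊥-least x = ⋁-least _ x λ _ ()

ν-postfixed : (L : CompleteLattice ℓ) (g : Car L → Car L) → Monotone L L g →
              CompleteLattice._≤_ L (Systems.fp L ν g) (g (Systems.fp L ν g))
ν-postfixed L g g-mono = Order.μ-prefixed (L ᵒᵖ) g (monotone-ᵒᵖ L L g-mono)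

module Pataraia (L : CompleteLattice ℓ) (g : Car L → Car L) (g-mono : Monotone L L g)
  (T : Car L → Set ℓ)
  (T-resp : ∀ {x y} → CompleteLattice._≈_ L x y → T x → T y)
  (T-g : ∀ {x} → T x → T (g x))
  (g-inflationary : ∀ {x} → T x → CompleteLattice._≤_ L x (g x))
  (T-⋁ : ∀ D → Directed L D → (∀ {x} → D x → T x) → T (CompleteLattice.⋁ L D))
  where
  open Order L

  record IsMonotoneInflationary (k : Carrier → Carrier) : Set ℓ where
    field
      preserves    : ∀ {x} → T x → T (k x)
      inflationary : ∀ {x} → T x → x ≤ k x
      monotone     : ∀ {x y} → T x → T y → x ≤ y → k x ≤ k y
  open IsMonotoneInflationary

  id-mi : IsMonotoneInflationary (λ x → x)
  id-mi = record { preserves = λ t → t ; inflationary = λ _ → ≤-refl ; monotone = λ _ _ x≤y → x≤y }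

  ∘-mi : ∀ {k k′} → IsMonotoneInflationary k → IsMonotoneInflationary k′ →
         IsMonotoneInflationary (λ x → k (k′ x))
  ∘-mi mk mk′ = record
    { preserves    = λ t → preserves mk (preserves mk′ t)
    ; inflationary = λ t → ≤-trans (inflationary mk′ t) (inflationary mk (preserves mk′ t))
    ; monotone     = λ tx ty x≤y →
        monotone mk (preserves mk′ tx) (preserves mk′ ty) (monotone mk′ tx ty x≤y)
    }

  Reachable : Carrier → Carrier → Set ℓ
  Reachable x y = Σ (Carrier → Carrier) λ k → IsMonotoneInflationary k × y ≈ k x

  reachable-directed : ∀ {x} → T x → Directed L (Reachable x)
  reachable-directed {x} tx = (x , _ , id-mi , Eq.refl) , upper-bound
    where
    upper-bound : ∀ y y′ → Reachable x y → Reachable x y′ →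
                  Σ Carrier λ z → Reachable x z × y ≤ z × y′ ≤ z
    upper-bound _ _ (k , mk , y≈kx) (k′ , mk′ , y′≈k′x) =
      k (k′ x) , (_ , ∘-mi mk mk′ , Eq.refl) ,
      ≤-trans (≤-reflexive y≈kx)
              (monotone mk tx (preserves mk′ tx) (inflationary mk′ tx)) ,
      ≤-trans (≤-reflexive y′≈k′x) (inflationary mk (preserves mk′ tx))

  k⋆ : Carrier → Carrier
  k⋆ x = ⋁ (Reachable x)

  k⋆-mi : IsMonotoneInflationary k⋆
  k⋆-mi = record
    { preserves    = λ tx → T-⋁ _ (reachable-directed tx)
        λ { (k , mk , y≈kx) → T-resp (Eq.sym y≈kx) (preserves mk tx) }
    ; inflationary = λ _ → ⋁-upper _ _ (_ , id-mi , Eq.refl)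
    ; monotone     = λ {x} {y} tx ty x≤y → ⋁-least _ _ λ
        { z (k , mk , z≈kx) → ≤-trans (≤-reflexive z≈kx)
            (≤-trans (monotone mk tx ty x≤y) (⋁-upper _ _ (k , mk , Eq.refl))) }
    }

  g∘k⋆-mi : IsMonotoneInflationary (λ x → g (k⋆ x))
  g∘k⋆-mi = record
    { preserves    = λ t → T-g (preserves k⋆-mi t)
    ; inflationary = λ t → ≤-trans (inflationary k⋆-mi t) (g-inflationary (preserves k⋆-mi t))
    ; monotone     = λ tx ty x≤y → g-mono _ _ (monotone k⋆-mi tx ty x≤y)
    }

  prefixed-point : ∀ {x} → T x → Σ Carrier λ e → T e × g e ≤ e
  prefixed-point {x} tx =
    k⋆ x , preserves k⋆-mi tx , ⋁-upper _ _ (_ , g∘k⋆-mi , Eq.refl)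

TransfersFixpoints : (X Y : CompleteLattice ℓ) → Fix → (Car X → Car Y → Set ℓ) → Set ℓ
TransfersFixpoints X Y e R =
  ∀ (gX : Car X → Car X) (gY : Car Y → Car Y) → Monotone X X gX → Monotone Y Y gY →
  (∀ x y → R x y → R (gX x) (gY y)) → R (Systems.fp X e gX) (Systems.fp Y e gY)

transfers-ᵒᵖ : (X Y : CompleteLattice ℓ) {R : Car X → Car Y → Set ℓ} (e : Fix) →
               TransfersFixpoints (X ᵒᵖ) (Y ᵒᵖ) (dual e) R → TransfersFixpoints X Y e R
transfers-ᵒᵖ X Y μ t gX gY gX-mono gY-mono = t gX gY (λ x y → gX-mono y x) (λ x y → gY-mono y x)
transfers-ᵒᵖ X Y ν t gX gY gX-mono gY-mono = t gX gY (λ x y → gX-mono y x) (λ x y → gY-mono y x)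

fp-mono : (L : CompleteLattice ℓ) (e : Fix) → TransfersFixpoints L L e (CompleteLattice._≤_ L)
fp-mono L μ gX gY _ _ step =
  ⋀-greatest _ _ λ y gYy≤y → ⋀-lower _ y (≤-trans (step y y ≤-refl) gYy≤y)
  where open Order L
fp-mono L ν gX gY gX-mono gY-mono step =
  fp-mono (L ᵒᵖ) μ gY gX (λ x y → gY-mono y x) (λ x y → gX-mono y x) λ x y y≤x → step y x y≤x

module _ (X Y : CompleteLattice ℓ) where
  private
    module X = Order X
    module Y = Order Y

  ν-transfer : (h : Car X → Car Y) → Monotone X Y h → TransfersFixpoints X Y ν (λ x y → h x Y.≤ y)
  ν-transfer h h-mono gX gY gX-mono _ step =
    Y.⋁-upper _ (h s) (Y.≤-trans (h-mono _ _ (ν-postfixed X gX gX-mono)) (step s (h s) Y.≤-refl))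
    where
    s : Car X
    s = X.fp ν gX

  leftAdjoint-μ-transfer : {α : Car X → Car Y} {γ : Car Y → Car X} → IsGaloisConnection X Y α γ →
                           TransfersFixpoints X Y μ (λ x y → α x Y.≤ y)
  leftAdjoint-μ-transfer {γ = γ} gc gX gY _ gY-mono step =
    adjunction-⇐ _ _ (X.⋀-lower _ (γ s) (adjunction-⇒ _ _
      (Y.≤-trans (step (γ s) s (adjunction-⇐ _ _ X.≤-refl)) (Y.μ-prefixed gY gY-mono))))
    where
    open IsGaloisConnection gc
    s : Car Y
    s = Y.fp μ gY

  continuous-μ-transfer : (h : Car X → Car Y) → Monotone X Y h → Continuous X Y h → Strict X Y h →
                          TransfersFixpoints X Y μ (λ x y → h x Y.≤ y)
  continuous-μ-transfer h h-mono h-cont h-strict gX gY gX-mono gY-mono step =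
    conclude (prefixed-point T-⊥)
    where
    s : Car Y
    s = Y.fp μ gY

    T : Car X → Set ℓ
    T x = h x Y.≤ s × x X.≤ gX x

    T-resp : ∀ {x y} → x X.≈ y → T x → T y
    T-resp {x} {y} x≈y (hx≤s , x≤gx) =
      Y.≤-trans (h-mono _ _ y≤x) hx≤s ,
      X.≤-trans y≤x (X.≤-trans x≤gx (gX-mono _ _ (X.≤-reflexive x≈y)))
      where
      y≤x : y X.≤ x
      y≤x = X.≤-reflexive (X.Eq.sym x≈y)

    T-g : ∀ {x} → T x → T (gX x)
    T-g {x} (hx≤s , x≤gx) = Y.≤-trans (step x s hx≤s) (Y.μ-prefixed gY gY-mono) , gX-mono _ _ x≤gx

    T-⋁ : ∀ D → Directed X D → (∀ {x} → D x → T x) → T (X.⋁ D)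
    T-⋁ D D-directed D⊆T =
      Y.≤-trans (Y.≤-reflexive (h-cont D D-directed))
        (Y.⋁-least _ s λ { y (d , d∈D , y≈hd) →
          Y.≤-trans (Y.≤-reflexive y≈hd) (proj₁ (D⊆T d∈D)) }) ,
      X.⋁-least D _ λ d d∈D → X.≤-trans (proj₂ (D⊆T d∈D)) (gX-mono _ _ (X.⋁-upper D d d∈D))

    T-⊥ : T X.bot
    T-⊥ = Y.≤-trans (Y.≤-reflexive h-strict) (Y.⊥-least s) , X.⊥-least _

    open Pataraia X gX gX-mono T T-resp T-g proj₂ T-⋁ using (prefixed-point)

    conclude : (Σ (Car X) λ e → T e × gX e X.≤ e) → h (X.fp μ gX) Y.≤ s
    conclude (e , (he≤s , _) , gXe≤e) = Y.≤-trans (h-mono _ _ (X.⋀-lower _ e gXe≤e)) he≤s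

-- f [last≔ l ] is the right-hand side of E[xₘ := l].
_[last≔_] : {A : Set ℓ} {m : ℕ} →
            (Fin (suc m) → (Fin (suc m) → A) → A) → A → Fin m → (Fin m → A) → A
(f [last≔ l ]) i v = f (inject₁ i) (snoc v l)

snoc-pointwise : ∀ {a b r} {A : Set a} {B : Set b} {m : ℕ} (R : Fin (suc m) → A → B → Set r)
                 {u : Fin m → A} {v : Fin m → B} {x : A} {y : B} →
                 (∀ i → R (inject₁ i) (u i) (v i)) → R (fromℕ m) x y →
                 ∀ j → R j (snoc u x j) (snoc v y j)
snoc-pointwise {m = zero}  R uRv xRy zero    = xRy
snoc-pointwise {m = suc m} R uRv xRy zero    = uRv zero
snoc-pointwise {m = suc m} R uRv xRy (suc j) =
  snoc-pointwise (λ k → R (suc k)) (λ i → uRv (suc i)) xRy j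

module LastEquation (L : CompleteLattice ℓ) {m : ℕ} (η : Fin (suc m) → Fix)
  (f : Fin (suc m) → (Fin (suc m) → Car L) → Car L) where

  rest : Car L → Fin m → Car L
  rest l = Systems.sol L m (init η) (f [last≔ l ])

  last-map : Car L → Car L
  last-map x = f (fromℕ m) (snoc (rest x) x)

module _ (L : CompleteLattice ℓ) {m : ℕ} {f : Fin (suc m) → (Fin (suc m) → Car L) → Car L}
  (f-mono : ∀ i → Systems.MonotoneTuple L (f i)) where
  open Order L
  open Systems L using (_≤ᵗ_)

  [last≔]-mono : ∀ {l l′} → l ≤ l′ → ∀ i u v → u ≤ᵗ v → (f [last≔ l ]) i u ≤ (f [last≔ l′ ]) i v
  [last≔]-mono l≤l′ i u v u≤v = f-mono (inject₁ i) _ _ (snoc-pointwise (λ _ → _≤_) u≤v l≤l′)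

  [last≔]-monotoneTuple : ∀ l i → Systems.MonotoneTuple L ((f [last≔ l ]) i)
  [last≔]-monotoneTuple l = [last≔]-mono ≤-refl

mutual
  sol-related : (X Y : CompleteLattice ℓ) (m : ℕ) (η : Fin m → Fix)
    (R : Fin m → Car X → Car Y → Set ℓ)
    (fX : Fin m → (Fin m → Car X) → Car X) (fY : Fin m → (Fin m → Car Y) → Car Y) →
    (∀ i → Systems.MonotoneTuple X (fX i)) → (∀ i → Systems.MonotoneTuple Y (fY i)) →
    (∀ i → TransfersFixpoints X Y (η i) (R i)) →
    (∀ i u v → (∀ j → R j (u j) (v j)) → R i (fX i u) (fY i v)) →
    ∀ i → R i (Systems.sol X m η fX i) (Systems.sol Y m η fY i)
  sol-related X Y zero η R fX fY fX-mono fY-mono transfer preserve ()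
  sol-related X Y (suc m) η R fX fY fX-mono fY-mono transfer preserve =
    snoc-pointwise R (rest-related last-related) last-related
    where
    module UX = LastEquation X η fX
    module UY = LastEquation Y η fY

    rest-related : ∀ {x y} → R (fromℕ m) x y → ∀ i → R (inject₁ i) (UX.rest x i) (UY.rest y i)
    rest-related {x} {y} xRy =
      sol-related X Y m (init η) (λ i → R (inject₁ i)) (fX [last≔ x ]) (fY [last≔ y ])
        ([last≔]-monotoneTuple X fX-mono x) ([last≔]-monotoneTuple Y fY-mono y)
        (λ i → transfer (inject₁ i))
        (λ i u v uRv → preserve (inject₁ i) _ _ (snoc-pointwise R uRv xRy))

    last-related : R (fromℕ m) (Systems.fp X (η (fromℕ m)) UX.last-map)
                               (Systems.fp Y (η (fromℕ m)) UY.last-map)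
    last-related =
      transfer (fromℕ m) UX.last-map UY.last-map
        (last-map-mono X m η fX fX-mono) (last-map-mono Y m η fY fY-mono)
        λ x y xRy → preserve (fromℕ m) _ _ (snoc-pointwise R (rest-related xRy) xRy)

  sol-mono : (L : CompleteLattice ℓ) (m : ℕ) (η : Fin m → Fix)
    (f f′ : Fin m → (Fin m → Car L) → Car L) →
    (∀ i → Systems.MonotoneTuple L (f i)) → (∀ i → Systems.MonotoneTuple L (f′ i)) →
    (∀ i u v → Systems._≤ᵗ_ L u v → CompleteLattice._≤_ L (f i u) (f′ i v)) →
    Systems._≤ᵗ_ L (Systems.sol L m η f) (Systems.sol L m η f′)
  sol-mono L m η f f′ f-mono f′-mono f≤f′ =
    sol-related L L m η (λ _ → CompleteLattice._≤_ L) f f′ f-mono f′-mono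
      (λ i → fp-mono L (η i)) f≤f′

  last-map-mono : (L : CompleteLattice ℓ) (m : ℕ) (η : Fin (suc m) → Fix)
    (f : Fin (suc m) → (Fin (suc m) → Car L) → Car L) →
    (∀ i → Systems.MonotoneTuple L (f i)) → Monotone L L (LastEquation.last-map L η f)
  last-map-mono L m η f f-mono x y x≤y =
    f-mono (fromℕ m) _ _ (snoc-pointwise (λ _ → CompleteLattice._≤_ L)
      (sol-mono L m (init η) (f [last≔ x ]) (f [last≔ y ])
        ([last≔]-monotoneTuple L f-mono x) ([last≔]-monotoneTuple L f-mono y)
        ([last≔]-mono L f-mono x≤y))
      x≤y)

lax-commutation-preserves : (X Y : CompleteLattice ℓ) {m : ℕ} (h : Fin m → Car X → Car Y)
  (fX : Fin m → (Fin m → Car X) → Car X) (fY : Fin m → (Fin m → Car Y) → Car Y) →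
  (∀ i → Systems.MonotoneTuple Y (fY i)) →
  (∀ v i → CompleteLattice._≤_ Y (h i (fX i v)) (fY i (λ j → h j (v j)))) →
  ∀ i u v → (∀ j → CompleteLattice._≤_ Y (h j (u j)) (v j)) →
  CompleteLattice._≤_ Y (h i (fX i u)) (fY i v)
lax-commutation-preserves X Y h fX fY fY-mono h∘fX≤fY∘h i u v hu≤v =
  Order.≤-trans Y (h∘fX≤fY∘h u i) (fY-mono i _ _ hu≤v)

module _ (C A : CompleteLattice ℓ) {m : ℕ} {α : Fin m → Car C → Car A} {γ : Fin m → Car A → Car C}
  (gc : ∀ i → IsGaloisConnection C A (α i) (γ i))
  (fC : Fin m → (Fin m → Car C) → Car C) (fA : Fin m → (Fin m → Car A) → Car A) where
  private
    module C = Order C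
    module A = Order A
    module G i = IsGaloisConnection (gc i)

  γ-commutation⇒α-commutation : (∀ i → Systems.MonotoneTuple C (fC i)) →
    (∀ v i → fC i (λ j → γ j (v j)) C.≤ γ i (fA i v)) →
    ∀ v i → α i (fC i v) A.≤ fA i (λ j → α j (v j))
  γ-commutation⇒α-commutation fC-mono fC∘γ≤γ∘fA v i = G.adjunction-⇐ i _ _
    (C.≤-trans (fC-mono i _ _ λ j → G.adjunction-⇒ j _ _ A.≤-refl) (fC∘γ≤γ∘fA (λ j → α j (v j)) i))

  α-commutation⇒γ-commutation : (∀ i → Systems.MonotoneTuple A (fA i)) →
    (∀ v i → α i (fC i v) A.≤ fA i (λ j → α j (v j))) →
    ∀ v i → fC i (λ j → γ j (v j)) C.≤ γ i (fA i v)
  α-commutation⇒γ-commutation fA-mono α∘fC≤fA∘α v i = G.adjunction-⇒ i _ _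
    (A.≤-trans (α∘fC≤fA∘α (λ j → γ j (v j)) i) (fA-mono i _ _ λ j → G.adjunction-⇐ j _ _ C.≤-refl))

module _ (X Y : CompleteLattice ℓ) where
  private
    module Y = CompleteLattice Y

  leftAdjoint-transfers : {α : Car X → Car Y} {γ : Car Y → Car X} → IsGaloisConnection X Y α γ →
                          ∀ e → TransfersFixpoints X Y e (λ x y → α x Y.≤ y)
  leftAdjoint-transfers gc μ = leftAdjoint-μ-transfer X Y gc
  leftAdjoint-transfers gc ν = ν-transfer X Y _ (IsGaloisConnection.α-mono gc)

  continuous-transfers : (h : Car X → Car Y) → Monotone X Y h →
                         ∀ e → (e ≡ μ → Continuous X Y h × Strict X Y h) →
                         TransfersFixpoints X Y e (λ x y → h x Y.≤ y)
  continuous-transfers h h-mono μ cs =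
    continuous-μ-transfer X Y h h-mono (proj₁ (cs refl)) (proj₂ (cs refl))
  continuous-transfers h h-mono ν _  = ν-transfer X Y h h-mono

  coContinuous-transfers : (h : Car X → Car Y) → Monotone X Y h →
                           ∀ e → (e ≡ ν → CoContinuous X Y h × CoStrict X Y h) →
                           TransfersFixpoints X Y e (λ x y → y Y.≤ h x)
  coContinuous-transfers h h-mono μ _ =
    transfers-ᵒᵖ X Y μ (ν-transfer (X ᵒᵖ) (Y ᵒᵖ) h (monotone-ᵒᵖ X Y h-mono))
  coContinuous-transfers h h-mono ν cc =
    transfers-ᵒᵖ X Y ν (continuous-μ-transfer (X ᵒᵖ) (Y ᵒᵖ) h (monotone-ᵒᵖ X Y h-mono)
                                           (proj₁ (cc refl)) (proj₂ (cc refl)))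

theorem4p2 : ∀ {ℓ : Level} (C A : CompleteLattice ℓ) (m : ℕ) (η : Fin m → Fix)
  (fC : Fin m → (Fin m → Car C) → Car C) (fA : Fin m → (Fin m → Car A) → Car A)
  → (∀ i → Systems.MonotoneTuple C (fC i))
  → (∀ i → Systems.MonotoneTuple A (fA i))
  → (α : Fin m → Car C → Car A) (γ : Fin m → Car A → Car C)
  → (∀ i → IsGaloisConnection C A (α i) (γ i))
  → let open CompleteLattice C using () renaming (_≤_ to _⊑_)
        open CompleteLattice A using (_≤_)
        sC = Systems.sol C m η fC
        sA = Systems.sol A m η fA
    in
    -- (1) soundness
    (((∀ (v : Fin m → Car A) i → fC i (λ j → γ j (v j)) ⊑ γ i (fA i v))
       ⇔ (∀ (v : Fin m → Car C) i → α i (fC i v) ≤ fA i (λ j → α j (v j))))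
     × ((∀ (v : Fin m → Car C) i → α i (fC i v) ≤ fA i (λ j → α j (v j)))
        → (∀ i → α i (sC i) ≤ sA i) × (∀ i → sC i ⊑ γ i (sA i))))
    -- (2) completeness for abstraction
    × ((∀ (v : Fin m → Car C) i → fA i (λ j → α j (v j)) ≤ α i (fC i v))
       → (∀ i → η i ≡ ν → CoContinuous C A (α i) × CoStrict C A (α i))
       → ∀ i → sA i ≤ α i (sC i))
    -- (3) completeness for concretisation
    × ((∀ (v : Fin m → Car A) i → γ i (fA i v) ⊑ fC i (λ j → γ j (v j)))
       → (∀ i → η i ≡ μ → Continuous A C (γ i) × Strict A C (γ i))
       → ∀ i → γ i (sA i) ⊑ sC i)
theorem4p2 C A m η fC fA fC-mono fA-mono α γ gc =
  ( mk⇔ (γ-commutation⇒α-commutation C A gc fC fA fC-mono)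
        (α-commutation⇒γ-commutation C A gc fC fA fA-mono)
  , λ α∘fC≤fA∘α →
      let α-sound = sol-related C A m η (λ i c a → α i c A.≤ a) fC fA fC-mono fA-mono
                      (λ i → leftAdjoint-transfers C A (gc i) (η i))
                      (lax-commutation-preserves C A α fC fA fA-mono α∘fC≤fA∘α)
      in α-sound , λ i → G.adjunction-⇒ i _ _ (α-sound i) )
  , (λ fA∘α≤α∘fC α-coContinuous →
      sol-related C A m η (λ i c a → a A.≤ α i c) fC fA fC-mono fA-mono
        (λ i → coContinuous-transfers C A (α i) (G.α-mono i) (η i) (α-coContinuous i))
        (lax-commutation-preserves (C ᵒᵖ) (A ᵒᵖ) α fC fA (λ i → monotoneTuple-ᵒᵖ A (fA-mono i))
           fA∘α≤α∘fC))
  , (λ γ∘fA≤fC∘γ γ-continuous →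
      sol-related A C m η (λ i a c → γ i a C.≤ c) fA fC fA-mono fC-mono
        (λ i → continuous-transfers A C (γ i) (G.γ-mono i) (η i) (γ-continuous i))
        (lax-commutation-preserves A C γ fA fC fC-mono γ∘fA≤fC∘γ))
  where
  module C = CompleteLattice C
  module A = CompleteLattice A
  module G i = IsGaloisConnection (gc i)
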